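{- Let $\lambda\in\mathbb{R}$ and let $n\geq 0$ be an integer. Then for every real $x\neq 0$, \[ \sum_{k=0}^{n}\binom{n}{k}\phi_{k,\lambda}(x)\,(1)_{n-k,\lambda}=\frac{1}{x}\,\phi_{n+1,\lambda}(x)+n\lambda\sum_{k=0}^{n-1}\binom{n-1}{k}\phi_{k,\lambda}(x)\,(1)_{n-k,\lambda}. \]
   Context: For $\lambda\in\mathbb{R}$, the generalized falling factorials are $(x)_{0,\lambda}=1$ and $(x)_{n,\lambda}=x(x-\lambda)(x-2\lambda)\cdots(x-(n-1)\lambda)$ for $n\ge 1$. The degenerate exponential is the formal power series $e_\lambda(t)=\sum_{n\ge 0}(1)_{n,\lambda}\frac{t^n}{n!}$. The degenerate Bell polynomials $\phi_{n,\lambda}(x)$ are defined by the generating function $e^{x(e_\lambda(t)-1)}=\sum_{n=0}^{\infty}\phi_{n,\lambda}(x)\frac{t^n}{n!}$ (as formal power series in $t$). An empty sum is $0$. -}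

module Defs where

open import Level using (Level; _⊔_)
open import Data.Nat using (ℕ; zero; suc; _∸_; _!)
open import Data.Nat.Combinatorics using (_C_)
open import Data.Product using (Σ)
open import Algebra.Bundles using (CommutativeRing; Semiring)

-- A commutative ring in which every positive integer n·1 is invertible
-- (i.e. a ℚ-algebra, the setting in which e^{…} and t^n/n! make sense).
-- ℝ is an instance.  `inv n` is an inverse of (suc n)·1.
module _ {c ℓ : Level} (R : CommutativeRing c ℓ) where
  open CommutativeRing R using (Carrier; _≈_; _+_; _*_; _-_; 0#; 1#; semiring)
  open import Algebra.Definitions.RawSemiring (Semiring.rawSemiring semiring) using (_×_)

  NatInverses : Set (c ⊔ ℓ)
  NatInverses = (n : ℕ) → Σ Carrier (λ y → ((suc n) × 1#) * y ≈ 1#)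

module Degenerate {c ℓ : Level} (R : CommutativeRing c ℓ) (inv : NatInverses R) where
  open CommutativeRing R public using (Carrier; _≈_; _+_; _*_; _-_; 0#; 1#; semiring)
  open import Algebra.Definitions.RawSemiring (Semiring.rawSemiring semiring) public using (_×_)
  open import Data.Product using (proj₁)

  invNat : ℕ → Carrier
  invNat zero    = 1#
  invNat (suc n) = proj₁ (inv n)

  invFact : ℕ → Carrier
  invFact zero    = 1#
  invFact (suc n) = invFact n * invNat (suc n)

  Σ< : ℕ → (ℕ → Carrier) → Carrier
  Σ< zero    f = 0#
  Σ< (suc n) f = Σ< n f + f n

  binom : ℕ → ℕ → Carrier
  binom n k = (n C k) × 1#

  fall : Carrier → Carrier → ℕ → Carrier
  fall λ' x zero    = 1#
  fall λ' x (suc n) = fall λ' x n * (x - (n × λ'))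

  FPS : Set c
  FPS = ℕ → Carrier

  _·_ : FPS → FPS → FPS
  (f · g) n = Σ< (suc n) (λ k → f k * g (n ∸ k))

  one : FPS
  one zero    = 1#
  one (suc n) = 0#

  pow : FPS → ℕ → FPS
  pow f zero    = one
  pow f (suc m) = pow f m · f

  -- exp(g) for g with zero constant term:  Σ_m g^m / m!
  -- (coefficient n only receives contributions from m ≤ n)
  expFPS : FPS → FPS
  expFPS g n = Σ< (suc n) (λ m → invFact m * pow g m n)

  eλ : Carrier → FPS
  eλ λ' n = fall λ' 1# n * invFact n

  xeλm1 : Carrier → Carrier → FPS
  xeλm1 λ' x zero    = 0#
  xeλm1 λ' x (suc n) = x * eλ λ' (suc n)

  -- degenerate Bell polynomial φ_{n,λ}(x) = n! · [t^n] e^{x(e_λ(t)-1)}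
  φ : Carrier → ℕ → Carrier → Carrier
  φ λ' n x = ((n !) × 1#) * expFPS (xeλm1 λ' x) n

-- Write E = e^{g} with g = x(e_λ(t) − 1) and θ = t d/dt.  Since g has no constant term,
-- θE = E · θg, and comparing coefficients gives the recurrence
-- φ_{n+1,λ}(x) = x Σ_k C(n,k) φ_{k,λ}(x) (1)_{n+1−k,λ}.  Splitting each falling factorial
-- of the left-hand side as (1)_{m,λ} = (1)_{m+1,λ} + mλ (1)_{m,λ} turns it into that sum
-- plus a correction, and C(n,k)(n − k) = n C(n−1,k) pulls the factor nλ out of the correction.
module Submission where

open import Defs
open import Level using (Level)
open import Algebra.Bundles using (CommutativeRing)
open import Data.Nat using (ℕ; zero; suc; _∸_; _≤_; _<_; _<?_; _!)
import Data.Nat as ℕ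
import Data.Nat.Properties as ℕₚ
open import Data.Nat.Combinatorics using (_C_)
open import Data.Product using (proj₁; proj₂)
open import Data.Sum using (inj₁; inj₂)
open import Relation.Nullary using (yes; no)
open import Relation.Binary.PropositionalEquality as ≡ using (_≡_)
import Relation.Binary.Reasoning.Setoid as SetoidReasoning

module BinomialIdentities where
  open import Data.Nat
  open import Data.Nat.Properties
  open import Data.Nat.Combinatorics using (nCk≡n!/k![n-k]!; k![n∸k]!∣n!)
  open import Data.Nat.DivMod using (m/n*n≡m)
  open import Data.Nat.Solver using (module +-*-Solver)
  open import Relation.Binary.PropositionalEquality using (_≡_; refl; sym; cong; module ≡-Reasoning)
  open +-*-Solver
  open ≡-Reasoning

  nCk*k!*[n∸k]!≡n! : ∀ {n k} → k ≤ n → (n C k) * k ! * (n ∸ k) ! ≡ n !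
  nCk*k!*[n∸k]!≡n! {n} {k} k≤n = begin
    (n C k) * k ! * (n ∸ k) !
      ≡⟨ *-assoc (n C k) (k !) ((n ∸ k) !) ⟩
    (n C k) * (k ! * (n ∸ k) !)
      ≡⟨ cong (_* (k ! * (n ∸ k) !)) (nCk≡n!/k![n-k]! k≤n) ⟩
    (n ! / (k ! * (n ∸ k) !)) {{k !* (n ∸ k) !≢0}} * (k ! * (n ∸ k) !)
      ≡⟨ m/n*n≡m {{k !* (n ∸ k) !≢0}} (k![n∸k]!∣n! k≤n) ⟩
    n ! ∎

  -- Both sides times k! (m ∸ k)! equal (1 + m)!.
  [1+m]Ck*[1+m∸k]≡[1+m]*mCk : ∀ {m k} → k ≤ m → (suc m C k) * (suc m ∸ k) ≡ suc m * (m C k)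
  [1+m]Ck*[1+m∸k]≡[1+m]*mCk {m} {k} k≤m = *-cancelʳ-≡ _ _ (k ! * (m ∸ k) !) {{k !* (m ∸ k) !≢0}} (begin
    (suc m C k) * (suc m ∸ k) * (k ! * (m ∸ k) !)
      ≡⟨ cong (λ z → (suc m C k) * z * (k ! * (m ∸ k) !)) 1+m∸k≡1+[m∸k] ⟩
    (suc m C k) * suc (m ∸ k) * (k ! * (m ∸ k) !)
      ≡⟨ solve 4 (λ a b c d → a :* b :* (c :* d) := a :* c :* (b :* d)) refl
                 (suc m C k) (suc (m ∸ k)) (k !) ((m ∸ k) !) ⟩
    (suc m C k) * k ! * suc (m ∸ k) !
      ≡⟨ cong (λ z → (suc m C k) * k ! * z !) (sym 1+m∸k≡1+[m∸k]) ⟩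
    (suc m C k) * k ! * (suc m ∸ k) !
      ≡⟨ nCk*k!*[n∸k]!≡n! (m≤n⇒m≤1+n k≤m) ⟩
    suc m * m !
      ≡⟨ cong (suc m *_) (sym (nCk*k!*[n∸k]!≡n! k≤m)) ⟩
    suc m * ((m C k) * k ! * (m ∸ k) !)
      ≡⟨ solve 4 (λ a b c d → a :* (b :* c :* d) := a :* b :* (c :* d)) refl
                 (suc m) (m C k) (k !) ((m ∸ k) !) ⟩
    suc m * (m C k) * (k ! * (m ∸ k) !) ∎)
    where
    1+m∸k≡1+[m∸k] : suc m ∸ k ≡ suc (m ∸ k)
    1+m∸k≡1+[m∸k] = +-∸-assoc 1 k≤m

open BinomialIdentities

module DegenerateBellIdentities {c ℓ : Level} (R : CommutativeRing c ℓ) (inv : NatInverses R) where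
  open Degenerate R inv
  open CommutativeRing R using (refl; sym; trans; reflexive; setoid; commutativeSemiring; +-cong; +-congˡ; +-congʳ;
    *-cong; *-congˡ; *-congʳ; +-comm; *-comm; +-assoc; *-assoc; +-identityˡ; +-identityʳ;
    *-identityˡ; *-identityʳ; -‿inverseˡ; zeroˡ; zeroʳ; distribˡ; distribʳ)
  open SetoidReasoning setoid
  open import Algebra.Properties.Semiring.Mult semiring using (×-homo-+; ×1-homo-*; ×-assoc-*; ×-congʳ)
  open import Algebra.Solver.Ring.NaturalCoefficients.Default commutativeSemiring
    using (solve; _:=_; _:+_; _:*_)

  Σ<-cong : ∀ n {f g : ℕ → Carrier} → (∀ k → k < n → f k ≈ g k) → Σ< n f ≈ Σ< n g
  Σ<-cong zero    f≈g = refl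
  Σ<-cong (suc n) f≈g = +-cong (Σ<-cong n (λ k k<n → f≈g k (ℕₚ.m<n⇒m<1+n k<n))) (f≈g n ℕₚ.≤-refl)

  Σ<-length-≡ : ∀ {m n} (f : ℕ → Carrier) → m ≡ n → Σ< m f ≈ Σ< n f
  Σ<-length-≡ f ≡.refl = refl

  Σ<-zero : ∀ n {f : ℕ → Carrier} → (∀ k → k < n → f k ≈ 0#) → Σ< n f ≈ 0#
  Σ<-zero n f≈0 = trans (Σ<-cong n f≈0) (constant-zero n)
    where
    constant-zero : ∀ n → Σ< n (λ _ → 0#) ≈ 0#
    constant-zero zero    = refl
    constant-zero (suc n) = trans (+-identityʳ _) (constant-zero n)

  Σ<-+ : ∀ n (f g : ℕ → Carrier) → Σ< n (λ k → f k + g k) ≈ Σ< n f + Σ< n g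
  Σ<-+ zero    f g = sym (+-identityʳ 0#)
  Σ<-+ (suc n) f g = trans (+-congʳ (Σ<-+ n f g))
    (solve 4 (λ a b c d → ((a :+ b) :+ (c :+ d)) := ((a :+ c) :+ (b :+ d))) refl _ _ _ _)

  *-distribˡ-Σ< : ∀ n x (f : ℕ → Carrier) → x * Σ< n f ≈ Σ< n (λ k → x * f k)
  *-distribˡ-Σ< zero    x f = zeroʳ x
  *-distribˡ-Σ< (suc n) x f = trans (distribˡ x _ _) (+-congʳ (*-distribˡ-Σ< n x f))

  *-distribʳ-Σ< : ∀ n x (f : ℕ → Carrier) → Σ< n f * x ≈ Σ< n (λ k → f k * x)
  *-distribʳ-Σ< zero    x f = zeroˡ x
  *-distribʳ-Σ< (suc n) x f = trans (distribʳ x _ _) (+-congʳ (*-distribʳ-Σ< n x f))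

  Σ<-head : ∀ n (f : ℕ → Carrier) → Σ< (suc n) f ≈ f 0 + Σ< n (λ k → f (suc k))
  Σ<-head zero    f = trans (+-identityˡ _) (sym (+-identityʳ _))
  Σ<-head (suc n) f = trans (+-congʳ (Σ<-head n f)) (+-assoc _ _ _)

  Σ<-reverse : ∀ n (f : ℕ → Carrier) → Σ< n f ≈ Σ< n (λ k → f (n ∸ suc k))
  Σ<-reverse zero    f = refl
  Σ<-reverse (suc n) f = begin
    Σ< n f + f n                      ≈⟨ +-congʳ (Σ<-reverse n f) ⟩
    Σ< n (λ k → f (n ∸ suc k)) + f n  ≈⟨ +-comm _ _ ⟩
    f n + Σ< n (λ k → f (n ∸ suc k))  ≈⟨ Σ<-head n (λ k → f (n ∸ k)) ⟨
    Σ< (suc n) (λ k → f (n ∸ k))      ∎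

  Σ<-swap : ∀ m n (F : ℕ → ℕ → Carrier) → Σ< m (λ k → Σ< n (F k)) ≈ Σ< n (λ j → Σ< m (λ k → F k j))
  Σ<-swap zero    n F = sym (Σ<-zero n (λ _ _ → refl))
  Σ<-swap (suc m) n F = trans (+-congʳ (Σ<-swap m n F)) (sym (Σ<-+ n _ _))

  Σ<-extend : ∀ m n (f : ℕ → Carrier) → m ≤ n → (∀ k → m ≤ k → k < n → f k ≈ 0#) → Σ< m f ≈ Σ< n f
  Σ<-extend m n f m≤n f≈0 with ℕₚ.m≤n⇒m<n∨m≡n m≤n
  ... | inj₂ ≡.refl = refl
  Σ<-extend m (suc n) f _ f≈0 | inj₁ m<1+n = trans (sym (+-identityʳ _))
    (+-cong (Σ<-extend m n f m≤n (λ k m≤k k<n → f≈0 k m≤k (ℕₚ.m<n⇒m<1+n k<n)))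
            (sym (f≈0 n m≤n ℕₚ.≤-refl)))
    where m≤n = ℕₚ.≤-pred m<1+n

  Σ<-triangle : ∀ n (F : ℕ → ℕ → Carrier) →
    Σ< n (λ k → Σ< (suc k) (λ j → F j k)) ≈ Σ< n (λ j → Σ< (n ∸ j) (λ i → F j (j ℕ.+ i)))
  Σ<-triangle zero    F = refl
  Σ<-triangle (suc n) F = begin
    Σ< n (λ k → Σ< (suc k) (λ j → F j k)) + Σ< (suc n) (λ j → F j n)
      ≈⟨ +-congʳ (Σ<-triangle n F) ⟩
    Σ< n (λ j → Σ< (n ∸ j) (λ i → F j (j ℕ.+ i))) + Σ< (suc n) (λ j → F j n)
      ≈⟨ +-congʳ (trans (+-congˡ (Σ<-length-≡ _ ((ℕₚ.n∸n≡0 n)))) (+-identityʳ _)) ⟨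
    (Σ< n (λ j → Σ< (n ∸ j) (λ i → F j (j ℕ.+ i))) + Σ< (n ∸ n) (λ i → F n (n ℕ.+ i)))
      + Σ< (suc n) (λ j → F j n)
      ≈⟨ Σ<-+ (suc n) _ _ ⟨
    Σ< (suc n) (λ j → Σ< (n ∸ j) (λ i → F j (j ℕ.+ i)) + F j n)
      ≈⟨ Σ<-cong (suc n) (λ j j<1+n → sym (add-diagonal (ℕₚ.≤-pred j<1+n))) ⟩
    Σ< (suc n) (λ j → Σ< (suc n ∸ j) (λ i → F j (j ℕ.+ i))) ∎
    where
    add-diagonal : ∀ {j} → j ≤ n →
      Σ< (suc n ∸ j) (λ i → F j (j ℕ.+ i)) ≈ Σ< (n ∸ j) (λ i → F j (j ℕ.+ i)) + F j n
    add-diagonal {j} j≤n = trans (Σ<-length-≡ _ ((ℕₚ.+-∸-assoc 1 j≤n)))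
      (+-congˡ (reflexive (≡.cong (F j) (ℕₚ.m+[n∸m]≡n j≤n))))

  infix 4 _≋_
  _≋_ : FPS → FPS → Set ℓ
  f ≋ g = ∀ n → f n ≈ g n

  _•_ : Carrier → FPS → FPS
  (a • f) n = a * f n

  θ : FPS → FPS
  θ f n = (n × 1#) * f n

  ·-cong : ∀ {f f′ g g′} → f ≋ f′ → g ≋ g′ → f · g ≋ f′ · g′
  ·-cong f≋f′ g≋g′ n = Σ<-cong (suc n) (λ k _ → *-cong (f≋f′ k) (g≋g′ (n ∸ k)))

  ·-comm : ∀ f g → f · g ≋ g · f
  ·-comm f g n = trans (Σ<-reverse (suc n) _)
    (Σ<-cong (suc n) (λ k k<1+n → trans (*-comm _ _)
      (*-congʳ (reflexive (≡.cong g (ℕₚ.m∸[m∸n]≡n (ℕₚ.≤-pred k<1+n)))))))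

  ·-assoc : ∀ f g h → (f · g) · h ≋ f · (g · h)
  ·-assoc f g h n = begin
    Σ< (suc n) (λ k → Σ< (suc k) (λ j → f j * g (k ∸ j)) * h (n ∸ k))
      ≈⟨ Σ<-cong (suc n) (λ k _ → *-distribʳ-Σ< (suc k) _ _) ⟩
    Σ< (suc n) (λ k → Σ< (suc k) (λ j → f j * g (k ∸ j) * h (n ∸ k)))
      ≈⟨ Σ<-triangle (suc n) (λ j k → f j * g (k ∸ j) * h (n ∸ k)) ⟩
    Σ< (suc n) (λ j → Σ< (suc n ∸ j) (λ i → f j * g ((j ℕ.+ i) ∸ j) * h (n ∸ (j ℕ.+ i))))
      ≈⟨ Σ<-cong (suc n) (λ j j<1+n → inner j (ℕₚ.≤-pred j<1+n)) ⟩
    Σ< (suc n) (λ j → f j * Σ< (suc (n ∸ j)) (λ i → g i * h (n ∸ j ∸ i))) ∎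
    where
    inner : ∀ j → j ≤ n → Σ< (suc n ∸ j) (λ i → f j * g ((j ℕ.+ i) ∸ j) * h (n ∸ (j ℕ.+ i)))
                          ≈ f j * Σ< (suc (n ∸ j)) (λ i → g i * h (n ∸ j ∸ i))
    inner j j≤n = begin
      Σ< (suc n ∸ j) (λ i → f j * g ((j ℕ.+ i) ∸ j) * h (n ∸ (j ℕ.+ i)))
        ≈⟨ Σ<-length-≡ _ ((ℕₚ.+-∸-assoc 1 j≤n)) ⟩
      Σ< (suc (n ∸ j)) (λ i → f j * g ((j ℕ.+ i) ∸ j) * h (n ∸ (j ℕ.+ i)))
        ≈⟨ Σ<-cong (suc (n ∸ j)) (λ i _ → trans (*-assoc _ _ _) (*-congˡ (*-cong
             (reflexive (≡.cong g (ℕₚ.m+n∸m≡n j i)))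
             (reflexive (≡.cong h (≡.sym (ℕₚ.∸-+-assoc n j i))))))) ⟩
      Σ< (suc (n ∸ j)) (λ i → f j * (g i * h (n ∸ j ∸ i)))
        ≈⟨ *-distribˡ-Σ< (suc (n ∸ j)) (f j) _ ⟨
      f j * Σ< (suc (n ∸ j)) (λ i → g i * h (n ∸ j ∸ i)) ∎

  •-· : ∀ a f g → (a • f) · g ≋ a • (f · g)
  •-· a f g n = trans (Σ<-cong (suc n) (λ k _ → *-assoc _ _ _)) (sym (*-distribˡ-Σ< (suc n) a _))

  θ-one : ∀ n → θ one n ≈ 0#
  θ-one zero    = zeroˡ _
  θ-one (suc n) = zeroʳ _

  θ-· : ∀ f g n → θ (f · g) n ≈ (θ f · g) n + (f · θ g) n
  θ-· f g n = begin
    (n × 1#) * Σ< (suc n) (λ k → f k * g (n ∸ k))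
      ≈⟨ *-distribˡ-Σ< (suc n) _ _ ⟩
    Σ< (suc n) (λ k → (n × 1#) * (f k * g (n ∸ k)))
      ≈⟨ Σ<-cong (suc n) (λ k k<1+n → split-weight k (ℕₚ.≤-pred k<1+n)) ⟩
    Σ< (suc n) (λ k → (k × 1#) * f k * g (n ∸ k) + f k * (((n ∸ k) × 1#) * g (n ∸ k)))
      ≈⟨ Σ<-+ (suc n) _ _ ⟩
    (θ f · g) n + (f · θ g) n ∎
    where
    split-weight : ∀ k → k ≤ n → (n × 1#) * (f k * g (n ∸ k))
                                ≈ (k × 1#) * f k * g (n ∸ k) + f k * (((n ∸ k) × 1#) * g (n ∸ k))
    split-weight k k≤n = begin
      (n × 1#) * (f k * g (n ∸ k))
        ≈⟨ *-congʳ (reflexive (≡.cong (_× 1#) (ℕₚ.m+[n∸m]≡n k≤n))) ⟨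
      ((k ℕ.+ (n ∸ k)) × 1#) * (f k * g (n ∸ k))
        ≈⟨ *-congʳ (×-homo-+ 1# k (n ∸ k)) ⟩
      ((k × 1#) + ((n ∸ k) × 1#)) * (f k * g (n ∸ k))
        ≈⟨ solve 4 (λ a b x y → ((a :+ b) :* (x :* y)) := ((a :* x :* y) :+ (x :* (b :* y)))) refl _ _ _ _ ⟩
      (k × 1#) * f k * g (n ∸ k) + f k * (((n ∸ k) × 1#) * g (n ∸ k)) ∎

  θ-pow : ∀ g m → θ (pow g (suc m)) ≋ (suc m × 1#) • (pow g m · θ g)
  θ-pow g zero n = begin
    θ (one · g) n                  ≈⟨ θ-· one g n ⟩
    (θ one · g) n + (one · θ g) n  ≈⟨ +-congʳ (Σ<-zero (suc n) (λ k _ → trans (*-congʳ (θ-one k)) (zeroˡ _))) ⟩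
    0# + (one · θ g) n             ≈⟨ +-identityˡ _ ⟩
    (one · θ g) n                  ≈⟨ *-identityˡ _ ⟨
    1# * (one · θ g) n             ≈⟨ *-congʳ (+-identityʳ 1#) ⟨
    (1# + 0#) * (one · θ g) n      ∎
  θ-pow g (suc m) n = begin
    θ (pow g (suc m) · g) n
      ≈⟨ θ-· (pow g (suc m)) g n ⟩
    (θ (pow g (suc m)) · g) n + (pow g (suc m) · θ g) n
      ≈⟨ +-congʳ (·-cong {g = g} {g′ = g} (θ-pow g m) (λ _ → refl) n) ⟩
    (((suc m × 1#) • (pow g m · θ g)) · g) n + (pow g (suc m) · θ g) n
      ≈⟨ +-congʳ (•-· (suc m × 1#) (pow g m · θ g) g n) ⟩
    (suc m × 1#) * ((pow g m · θ g) · g) n + (pow g (suc m) · θ g) n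
      ≈⟨ +-congʳ (*-congˡ (begin
          ((pow g m · θ g) · g) n  ≈⟨ ·-assoc (pow g m) (θ g) g n ⟩
          (pow g m · (θ g · g)) n  ≈⟨ ·-cong {pow g m} (λ _ → refl) (·-comm (θ g) g) n ⟩
          (pow g m · (g · θ g)) n  ≈⟨ ·-assoc (pow g m) g (θ g) n ⟨
          (pow g (suc m) · θ g) n  ∎)) ⟩
    (suc m × 1#) * (pow g (suc m) · θ g) n + (pow g (suc m) · θ g) n
      ≈⟨ +-comm _ _ ⟩
    (pow g (suc m) · θ g) n + (suc m × 1#) * (pow g (suc m) · θ g) n
      ≈⟨ +-congʳ (*-identityˡ _) ⟨
    1# * (pow g (suc m) · θ g) n + (suc m × 1#) * (pow g (suc m) · θ g) n
      ≈⟨ distribʳ _ _ _ ⟨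
    (1# + (suc m × 1#)) * (pow g (suc m) · θ g) n ∎

  ·-vanishes-below : ∀ {f g : FPS} m → g 0 ≈ 0# → (∀ j → j < m → f j ≈ 0#) →
                     ∀ j → j < suc m → (f · g) j ≈ 0#
  ·-vanishes-below {f} {g} m g₀≈0 f≈0 j j<1+m = Σ<-zero (suc j) term≈0
    where
    term≈0 : ∀ k → k < suc j → f k * g (j ∸ k) ≈ 0#
    term≈0 k _ with k <? m
    ... | yes k<m = trans (*-congʳ (f≈0 k k<m)) (zeroˡ _)
    ... | no  k≮m = trans (*-congˡ (trans (reflexive (≡.cong g (ℕₚ.m≤n⇒m∸n≡0 j≤k))) g₀≈0)) (zeroʳ _)
      where j≤k = ℕₚ.≤-trans (ℕₚ.≤-pred j<1+m) (ℕₚ.≮⇒≥ k≮m)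

  pow-vanishes-below : ∀ {g} → g 0 ≈ 0# → ∀ m j → j < m → pow g m j ≈ 0#
  pow-vanishes-below g₀≈0 zero    j ()
  pow-vanishes-below {g} g₀≈0 (suc m) = ·-vanishes-below {pow g m} {g} m g₀≈0 (pow-vanishes-below g₀≈0 m)

  invFact-suc-cancel : ∀ m x → invFact (suc m) * ((suc m × 1#) * x) ≈ invFact m * x
  invFact-suc-cancel m x = begin
    (invFact m * proj₁ (inv m)) * ((suc m × 1#) * x)
      ≈⟨ solve 4 (λ i y s x → ((i :* y) :* (s :* x)) := (i :* ((s :* y) :* x))) refl _ _ _ _ ⟩
    invFact m * (((suc m × 1#) * proj₁ (inv m)) * x)
      ≈⟨ *-congˡ (trans (*-congʳ (proj₂ (inv m))) (*-identityˡ x)) ⟩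
    invFact m * x ∎

  -- By θ-pow, θ(g^m)/m! = g^{m−1} θg/(m−1)!; summing over m gives E · θg.
  θ-exp : ∀ {g} → g 0 ≈ 0# → θ (expFPS g) ≋ expFPS g · θ g
  θ-exp {g} g₀≈0 n = trans θE≈S (sym E·θg≈S)
    where
    S : Carrier
    S = Σ< n (λ m → invFact m * (pow g m · θ g) n)

    θE≈S : θ (expFPS g) n ≈ S
    θE≈S = begin
      (n × 1#) * Σ< (suc n) (λ m → invFact m * pow g m n)
        ≈⟨ *-distribˡ-Σ< (suc n) _ _ ⟩
      Σ< (suc n) (λ m → (n × 1#) * (invFact m * pow g m n))
        ≈⟨ Σ<-head n _ ⟩
      (n × 1#) * (1# * one n) + Σ< n (λ m → (n × 1#) * (invFact (suc m) * pow g (suc m) n))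
        ≈⟨ +-cong (trans (*-congˡ (*-identityˡ _)) (θ-one n))
                  (Σ<-cong n (λ m _ → trans (solve 3 (λ c a b → (c :* (a :* b)) := (a :* (c :* b))) refl _ _ _)
                    (trans (*-congˡ (θ-pow g m n)) (invFact-suc-cancel m _)))) ⟩
      0# + S
        ≈⟨ +-identityˡ S ⟩
      S ∎

    last-term≈0 : (pow g n · θ g) n ≈ 0#
    last-term≈0 = ·-vanishes-below {pow g n} {θ g} n (zeroˡ _) (pow-vanishes-below g₀≈0 n) n ℕₚ.≤-refl

    E·θg≈S : (expFPS g · θ g) n ≈ S
    E·θg≈S = begin
      Σ< (suc n) (λ k → expFPS g k * θ g (n ∸ k))
        ≈⟨ Σ<-cong (suc n) (λ k k<1+n → *-congʳ (Σ<-extend (suc k) (suc n) _ k<1+n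
             (λ m 1+k≤m _ → trans (*-congˡ (pow-vanishes-below g₀≈0 m k 1+k≤m)) (zeroʳ _)))) ⟩
      Σ< (suc n) (λ k → Σ< (suc n) (λ m → invFact m * pow g m k) * θ g (n ∸ k))
        ≈⟨ Σ<-cong (suc n) (λ k _ → *-distribʳ-Σ< (suc n) _ _) ⟩
      Σ< (suc n) (λ k → Σ< (suc n) (λ m → invFact m * pow g m k * θ g (n ∸ k)))
        ≈⟨ Σ<-swap (suc n) (suc n) _ ⟩
      Σ< (suc n) (λ m → Σ< (suc n) (λ k → invFact m * pow g m k * θ g (n ∸ k)))
        ≈⟨ Σ<-cong (suc n) (λ m _ → trans (Σ<-cong (suc n) (λ k _ → *-assoc _ _ _))
                                          (sym (*-distribˡ-Σ< (suc n) _ _))) ⟩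
      S + invFact n * (pow g n · θ g) n
        ≈⟨ +-congˡ (trans (*-congˡ last-term≈0) (zeroʳ _)) ⟩
      S + 0#
        ≈⟨ +-identityʳ S ⟩
      S ∎

  n×x≈n×1#*x : ∀ n x → n × x ≈ (n × 1#) * x
  n×x≈n×1#*x n x = sym (trans (×-assoc-* n 1# x) (×-congʳ n (*-identityˡ x)))

  n!*invFact[n]≈1 : ∀ n → ((n !) × 1#) * invFact n ≈ 1#
  n!*invFact[n]≈1 zero    = trans (*-identityʳ _) (+-identityʳ 1#)
  n!*invFact[n]≈1 (suc n) = begin
    ((suc n ℕ.* n !) × 1#) * invFact (suc n)          ≈⟨ *-congʳ (×1-homo-* (suc n) (n !)) ⟩
    ((suc n × 1#) * ((n !) × 1#)) * invFact (suc n)   ≈⟨ *-comm _ _ ⟩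
    invFact (suc n) * ((suc n × 1#) * ((n !) × 1#))   ≈⟨ invFact-suc-cancel n _ ⟩
    invFact n * ((n !) × 1#)                          ≈⟨ *-comm _ _ ⟩
    ((n !) × 1#) * invFact n                          ≈⟨ n!*invFact[n]≈1 n ⟩
    1# ∎

  n!*invFact[n∸k]≈binom*k! : ∀ {n k} → k ≤ n → ((n !) × 1#) * invFact (n ∸ k) ≈ binom n k * ((k !) × 1#)
  n!*invFact[n∸k]≈binom*k! {n} {k} k≤n = begin
    ((n !) × 1#) * invFact (n ∸ k)
      ≈⟨ *-congʳ (reflexive (≡.cong (_× 1#) (nCk*k!*[n∸k]!≡n! k≤n))) ⟨
    (((n C k) ℕ.* k ! ℕ.* (n ∸ k) !) × 1#) * invFact (n ∸ k)
      ≈⟨ *-congʳ (trans (×1-homo-* ((n C k) ℕ.* k !) ((n ∸ k) !)) (*-congʳ (×1-homo-* (n C k) (k !)))) ⟩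
    (binom n k * ((k !) × 1#)) * (((n ∸ k) !) × 1#) * invFact (n ∸ k)
      ≈⟨ *-assoc _ _ _ ⟩
    (binom n k * ((k !) × 1#)) * ((((n ∸ k) !) × 1#) * invFact (n ∸ k))
      ≈⟨ *-congˡ (n!*invFact[n]≈1 (n ∸ k)) ⟩
    (binom n k * ((k !) × 1#)) * 1#
      ≈⟨ *-identityʳ _ ⟩
    binom n k * ((k !) × 1#) ∎

  binom*[1+m∸k]≈[1+m]*binom : ∀ {m k} → k ≤ m → binom (suc m) k * ((suc m ∸ k) × 1#) ≈ (suc m × 1#) * binom m k
  binom*[1+m∸k]≈[1+m]*binom {m} {k} k≤m = begin
    binom (suc m) k * ((suc m ∸ k) × 1#)  ≈⟨ ×1-homo-* (suc m C k) (suc m ∸ k) ⟨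
    ((suc m C k) ℕ.* (suc m ∸ k)) × 1#    ≈⟨ reflexive (≡.cong (_× 1#) ([1+m]Ck*[1+m∸k]≡[1+m]*mCk k≤m)) ⟩
    (suc m ℕ.* (m C k)) × 1#              ≈⟨ ×1-homo-* (suc m) (m C k) ⟩
    (suc m × 1#) * binom m k              ∎

  Σ<-binom-absorb : ∀ n (u w : ℕ → Carrier) y →
    Σ< (suc n) (λ k → binom n k * u k * w k * ((n ∸ k) × y)) ≈ (n × y) * Σ< n (λ k → binom (n ∸ 1) k * u k * w k)
  Σ<-binom-absorb n u w y = begin
    Σ< n (λ k → binom n k * u k * w k * ((n ∸ k) × y)) + binom n n * u n * w n * ((n ∸ n) × y)
      ≈⟨ +-congˡ (trans (*-congˡ (reflexive (≡.cong (_× y) (ℕₚ.n∸n≡0 n)))) (zeroʳ _)) ⟩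
    Σ< n (λ k → binom n k * u k * w k * ((n ∸ k) × y)) + 0#
      ≈⟨ +-identityʳ _ ⟩
    Σ< n (λ k → binom n k * u k * w k * ((n ∸ k) × y))
      ≈⟨ absorb n ⟩
    (n × y) * Σ< n (λ k → binom (n ∸ 1) k * u k * w k) ∎
    where
    absorb : ∀ n → Σ< n (λ k → binom n k * u k * w k * ((n ∸ k) × y))
                 ≈ (n × y) * Σ< n (λ k → binom (n ∸ 1) k * u k * w k)
    absorb zero    = sym (zeroʳ _)
    absorb (suc m) = trans (Σ<-cong (suc m) term) (sym (*-distribˡ-Σ< (suc m) _ _))
      where
      term : ∀ k → k < suc m → binom (suc m) k * u k * w k * ((suc m ∸ k) × y)
                             ≈ (suc m × y) * (binom m k * u k * w k)
      term k k<1+m = begin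
        binom (suc m) k * u k * w k * ((suc m ∸ k) × y)
          ≈⟨ *-congˡ (n×x≈n×1#*x (suc m ∸ k) y) ⟩
        binom (suc m) k * u k * w k * (((suc m ∸ k) × 1#) * y)
          ≈⟨ solve 5 (λ b u w d y → (b :* u :* w :* (d :* y)) := ((b :* d) :* (y :* (u :* w)))) refl _ _ _ _ _ ⟩
        (binom (suc m) k * ((suc m ∸ k) × 1#)) * (y * (u k * w k))
          ≈⟨ *-congʳ (binom*[1+m∸k]≈[1+m]*binom (ℕₚ.≤-pred k<1+m)) ⟩
        ((suc m × 1#) * binom m k) * (y * (u k * w k))
          ≈⟨ solve 5 (λ s b y u w → ((s :* b) :* (y :* (u :* w))) := ((s :* y) :* (b :* u :* w))) refl _ _ _ _ _ ⟩
        ((suc m × 1#) * y) * (binom m k * u k * w k)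
          ≈⟨ *-congʳ (n×x≈n×1#*x (suc m) y) ⟨
        (suc m × y) * (binom m k * u k * w k) ∎

  fall-suc-split : ∀ λ' m → fall λ' 1# m ≈ fall λ' 1# (suc m) + fall λ' 1# m * (m × λ')
  fall-suc-split λ' m = begin
    fall λ' 1# m                                               ≈⟨ *-identityʳ _ ⟨
    fall λ' 1# m * 1#                                          ≈⟨ *-congˡ 1-L+L≈1 ⟨
    fall λ' 1# m * ((1# - (m × λ')) + (m × λ'))                ≈⟨ distribˡ _ _ _ ⟩
    fall λ' 1# m * (1# - (m × λ')) + fall λ' 1# m * (m × λ')  ∎
    where
    1-L+L≈1 : (1# - (m × λ')) + (m × λ') ≈ 1#
    1-L+L≈1 = trans (+-assoc _ _ _) (trans (+-congˡ (-‿inverseˡ _)) (+-identityʳ _))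

  θ-xeλm1-suc : ∀ λ' x j → θ (xeλm1 λ' x) (suc j) ≈ x * (fall λ' 1# (suc j) * invFact j)
  θ-xeλm1-suc λ' x j = begin
    (suc j × 1#) * (x * (fall λ' 1# (suc j) * (invFact j * proj₁ (inv j))))
      ≈⟨ solve 5 (λ s x a i y → (s :* (x :* (a :* (i :* y)))) := ((s :* y) :* (x :* (a :* i)))) refl _ _ _ _ _ ⟩
    ((suc j × 1#) * proj₁ (inv j)) * (x * (fall λ' 1# (suc j) * invFact j))
      ≈⟨ trans (*-congʳ (proj₂ (inv j))) (*-identityˡ _) ⟩
    x * (fall λ' 1# (suc j) * invFact j) ∎

  φ-suc : ∀ λ' x n →
    φ λ' (suc n) x ≈ x * Σ< (suc n) (λ k → binom n k * φ λ' k x * fall λ' 1# (suc (n ∸ k)))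
  φ-suc λ' x n = begin
    ((suc n ℕ.* n !) × 1#) * E (suc n)
      ≈⟨ *-congʳ (×1-homo-* (suc n) (n !)) ⟩
    ((suc n × 1#) * ((n !) × 1#)) * E (suc n)
      ≈⟨ solve 3 (λ s f e → ((s :* f) :* e) := (f :* (s :* e))) refl _ _ _ ⟩
    ((n !) × 1#) * θ E (suc n)
      ≈⟨ *-congˡ (θ-exp refl (suc n)) ⟩
    ((n !) × 1#) * (Σ< (suc n) (λ k → E k * θ g (suc n ∸ k)) + E (suc n) * θ g (n ∸ n))
      ≈⟨ *-congˡ (trans (+-congˡ (trans (*-congˡ θg[n∸n]≈0) (zeroʳ _))) (+-identityʳ _)) ⟩
    ((n !) × 1#) * Σ< (suc n) (λ k → E k * θ g (suc n ∸ k))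
      ≈⟨ *-distribˡ-Σ< (suc n) _ _ ⟩
    Σ< (suc n) (λ k → ((n !) × 1#) * (E k * θ g (suc n ∸ k)))
      ≈⟨ Σ<-cong (suc n) (λ k k<1+n → term k (ℕₚ.≤-pred k<1+n)) ⟩
    Σ< (suc n) (λ k → x * (binom n k * φ λ' k x * fall λ' 1# (suc (n ∸ k))))
      ≈⟨ *-distribˡ-Σ< (suc n) x _ ⟨
    x * Σ< (suc n) (λ k → binom n k * φ λ' k x * fall λ' 1# (suc (n ∸ k))) ∎
    where
    g : FPS
    g = xeλm1 λ' x

    E : FPS
    E = expFPS g

    θg[n∸n]≈0 : θ g (n ∸ n) ≈ 0#
    θg[n∸n]≈0 = trans (reflexive (≡.cong (θ g) (ℕₚ.n∸n≡0 n))) (zeroˡ _)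

    term : ∀ k → k ≤ n → ((n !) × 1#) * (E k * θ g (suc n ∸ k))
                       ≈ x * (binom n k * φ λ' k x * fall λ' 1# (suc (n ∸ k)))
    term k k≤n = begin
      ((n !) × 1#) * (E k * θ g (suc n ∸ k))
        ≈⟨ *-congˡ (*-congˡ (trans (reflexive (≡.cong (θ g) (ℕₚ.+-∸-assoc 1 k≤n)))
                                   (θ-xeλm1-suc λ' x (n ∸ k)))) ⟩
      ((n !) × 1#) * (E k * (x * (fall λ' 1# (suc (n ∸ k)) * invFact (n ∸ k))))
        ≈⟨ solve 5 (λ f e x a i → (f :* (e :* (x :* (a :* i)))) := (x :* ((f :* i) :* (e :* a)))) refl _ _ _ _ _ ⟩
      x * ((((n !) × 1#) * invFact (n ∸ k)) * (E k * fall λ' 1# (suc (n ∸ k))))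
        ≈⟨ *-congˡ (*-congʳ (n!*invFact[n∸k]≈binom*k! k≤n)) ⟩
      x * ((binom n k * ((k !) × 1#)) * (E k * fall λ' 1# (suc (n ∸ k))))
        ≈⟨ *-congˡ (solve 4 (λ b f e a → ((b :* f) :* (e :* a)) := (b :* (f :* e) :* a)) refl _ _ _ _) ⟩
      x * (binom n k * φ λ' k x * fall λ' 1# (suc (n ∸ k))) ∎

theorem1 : {c ℓ : Level} (R : CommutativeRing c ℓ) (inv : NatInverses R)
    → let open Degenerate R inv
    in (λ' : Carrier) (n : ℕ) (x x⁻¹ : Carrier) → x * x⁻¹ ≈ 1#
    → Σ< (suc n) (λ k → binom n k * φ λ' k x * fall λ' 1# (n ∸ k))
    ≈ x⁻¹ * φ λ' (suc n) x
    + (n × λ') * Σ< n (λ k → binom (n ∸ 1) k * φ λ' k x * fall λ' 1# (n ∸ k))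
theorem1 R inv λ' n x x⁻¹ x*x⁻¹≈1 = begin
  Σ< (suc n) (λ k → binom n k * φ λ' k x * fall λ' 1# (n ∸ k))
    ≈⟨ Σ<-cong (suc n) (λ k _ → split k) ⟩
  Σ< (suc n) (λ k → A k + D k)
    ≈⟨ Σ<-+ (suc n) A D ⟩
  Σ< (suc n) A + Σ< (suc n) D
    ≈⟨ +-cong (sym x⁻¹*φ[1+n]≈ΣA) (Σ<-binom-absorb n (λ k → φ λ' k x) (λ k → fall λ' 1# (n ∸ k)) λ') ⟩
  x⁻¹ * φ λ' (suc n) x + (n × λ') * Σ< n (λ k → binom (n ∸ 1) k * φ λ' k x * fall λ' 1# (n ∸ k)) ∎
  where
  open Degenerate R inv
  open CommutativeRing R
    using (sym; trans; setoid; +-cong; +-congˡ; *-congˡ; *-congʳ; *-comm; *-assoc; *-identityˡ; distribˡ)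
  open DegenerateBellIdentities R inv
  open SetoidReasoning setoid

  A D : ℕ → Carrier
  A k = binom n k * φ λ' k x * fall λ' 1# (suc (n ∸ k))
  D k = binom n k * φ λ' k x * fall λ' 1# (n ∸ k) * ((n ∸ k) × λ')

  split : ∀ k → binom n k * φ λ' k x * fall λ' 1# (n ∸ k) ≈ A k + D k
  split k = trans (*-congˡ (fall-suc-split λ' (n ∸ k))) (trans (distribˡ _ _ _) (+-congˡ (sym (*-assoc _ _ _))))

  x⁻¹*φ[1+n]≈ΣA : x⁻¹ * φ λ' (suc n) x ≈ Σ< (suc n) A
  x⁻¹*φ[1+n]≈ΣA = begin
    x⁻¹ * φ λ' (suc n) x         ≈⟨ *-congˡ (φ-suc λ' x n) ⟩
    x⁻¹ * (x * Σ< (suc n) A)     ≈⟨ *-assoc _ _ _ ⟨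
    (x⁻¹ * x) * Σ< (suc n) A     ≈⟨ *-congʳ (trans (*-comm _ _) x*x⁻¹≈1) ⟩
    1# * Σ< (suc n) A            ≈⟨ *-identityˡ _ ⟩
    Σ< (suc n) A                 ∎
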